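{- Let $T$ be a finite tree, $\mathcal{M}\in\{\mathcal{MIN},\mathcal{MAJ}\}$, $c\in\mathcal{C}^2_{\mathcal{M}}(T)$, and $T'$ a connected component of $T^f$ (resp. of $T^t$). Then the restriction of $c$ to $T'$ is a fixed point (resp. a pure 2-cycle) of $\mathcal{M}$ on $T'$.
   Context: Colorings are maps $c:V\to\{0,1\}$; $N^i(v)$ is the set of neighbors of $v$ with color $i$. $\mathcal{MIN}(c)(v)=c(v)$ if $|N^{c(v)}(v)|\le|N^{1-c(v)}(v)|$, else $1-c(v)$; $\mathcal{MAJ}(c)(v)=c(v)$ if $|N^{c(v)}(v)|\ge|N^{1-c(v)}(v)|$, else $1-c(v)$ (simultaneous update). $\mathcal{C}^2_{\mathcal{M}}(T)$ is the set of colorings $c$ with $\mathcal{M}(c)\ne c$ and $\mathcal{M}(\mathcal{M}(c))=c$. A node $u$ is a fixed node of $c$ if $\mathcal{M}(c)(u)=c(u)$, and a toggle node otherwise. $T^f$ (resp. $T^t$) is the subgraph of $T$ induced by the fixed (resp. toggle) nodes. A pure 2-cycle on a tree $T'$ is a coloring $c'$ with $\mathcal{M}(\mathcal{M}(c'))=c'$ and $\mathcal{M}(c')(v)\ne c'(v)$ for all nodes $v$ of $T'$ (the process computed within $T'$). -}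

module Defs where

open import Data.Nat using (ℕ; zero; suc; _≤_; _≤ᵇ_)
open import Data.Bool using (Bool; true; false; not; _∧_; if_then_else_)
open import Data.Fin using (Fin)
open import Data.List using (List; []; _∷_; length; map; take; _++_; allFin)
open import Data.Nat.ListAction using (sum)
open import Data.List.Relation.Unary.Unique.Propositional using (Unique)
open import Data.Product using (Σ; _×_; ∃)
open import Data.Unit using (⊤)
open import Relation.Binary.PropositionalEquality using (_≡_; _≢_)
open import Relation.Nullary using (¬_)

Graph : ℕ → Set
Graph n = Fin n → Fin n → Bool

Coloring : ℕ → Set
Coloring n = Fin n → Bool      -- false ~ colour 0, true ~ colour 1

data Walk {n : ℕ} (adj : Graph n) : Fin n → Fin n → Set where
  here : ∀ {u} → Walk adj u u
  step : ∀ {u w v} → adj u w ≡ true → Walk adj w v → Walk adj u v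

AdjChain : ∀ {n} → Graph n → List (Fin n) → Set
AdjChain adj [] = ⊤
AdjChain adj (x ∷ []) = ⊤
AdjChain adj (x ∷ y ∷ r) = (adj x y ≡ true) × AdjChain adj (y ∷ r)

Cycle : ∀ {n} → Graph n → Set
Cycle {n} adj = Σ (List (Fin n)) λ xs →
  (3 ≤ length xs) × Unique xs × AdjChain adj (xs ++ take 1 xs)

Symmetric : ∀ {n} → Graph n → Set
Symmetric adj = ∀ u v → adj u v ≡ adj v u

Irreflexive : ∀ {n} → Graph n → Set
Irreflexive adj = ∀ u → adj u u ≡ false

Connected : ∀ {n} → Graph n → Set
Connected adj = ∀ u v → Walk adj u v

IsTree : ∀ {n} → Graph n → Set
IsTree adj = Symmetric adj × Irreflexive adj × Connected adj × ¬ Cycle adj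

eqB : Bool → Bool → Bool
eqB true b = b
eqB false b = not b

nbCount : ∀ {n} → Graph n → Coloring n → Fin n → Bool → ℕ
nbCount {n} adj c v b =
  sum (map (λ u → if adj v u ∧ eqB (c u) b then 1 else 0) (allFin n))

data Rule : Set where
  MIN MAJ : Rule

update : ∀ {n} → Rule → Graph n → Coloring n → Coloring n
update MIN adj c v =
  if nbCount adj c v (c v) ≤ᵇ nbCount adj c v (not (c v)) then c v else not (c v)
update MAJ adj c v =
  if nbCount adj c v (not (c v)) ≤ᵇ nbCount adj c v (c v) then c v else not (c v)

InC2 : ∀ {n} → Rule → Graph n → Coloring n → Set
InC2 M adj c = (¬ (∀ v → update M adj c v ≡ c v))
             × (∀ v → update M adj (update M adj c) v ≡ c v)

fixedB : ∀ {n} → Rule → Graph n → Coloring n → Fin n → Bool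
fixedB M adj c u = eqB (update M adj c u) (c u)

toggleB : ∀ {n} → Rule → Graph n → Coloring n → Fin n → Bool
toggleB M adj c u = not (fixedB M adj c u)

-- Subgraph induced by the vertex subset S (vertices outside S become isolated
-- and are never referred to).
induced : ∀ {n} → Graph n → (Fin n → Bool) → Graph n
induced adj S u v = S u ∧ S v ∧ adj u v

_⊆_ : ∀ {n} → (Fin n → Bool) → (Fin n → Bool) → Set
S ⊆ P = ∀ v → S v ≡ true → P v ≡ true

ConnectedOn : ∀ {n} → Graph n → (Fin n → Bool) → Set
ConnectedOn adj S = ∀ u v → S u ≡ true → S v ≡ true → Walk (induced adj S) u v

IsComponent : ∀ {n} → Graph n → (Fin n → Bool) → (Fin n → Bool) → Set
IsComponent {n} adj P S =
  (∃ λ v → S v ≡ true) × (S ⊆ P) × ConnectedOn adj S ×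
  (∀ (S' : Fin n → Bool) → S ⊆ S' → S' ⊆ P → ConnectedOn adj S' → S' ⊆ S)

FixedPointOn : ∀ {n} → Rule → Graph n → (Fin n → Bool) → Coloring n → Set
FixedPointOn M adj S c =
  ∀ v → S v ≡ true → update M (induced adj S) c v ≡ c v

PureTwoCycleOn : ∀ {n} → Rule → Graph n → (Fin n → Bool) → Coloring n → Set
PureTwoCycleOn M adj S c =
  ∀ v → S v ≡ true →
    (update M (induced adj S) (update M (induced adj S) c) v ≡ c v)
    × (update M (induced adj S) c v ≢ c v)

module Submission where

-- Let S be a component of the fixed (or toggle) nodes of c and v ∈ S. By maximality of S, a
-- neighbour of v lies in S exactly when it has the same status as v. Split the neighbours of v
-- into those inside/outside S that agree/disagree in colour with v, with counts a, b, s, o.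
-- The rule at v compares a + s with b + o under c, and a + o with b + s under M(c), since
-- relative to v only the outside neighbours change colour; because M(M(c)) = c, v has the same
-- status in both steps. Both threshold rules survive averaging these two comparisons, so the
-- induced subgraph, where v compares a with b, gives v that status again. On a toggle component
-- every node thus toggles, and flipping all colours leaves agreement counts unchanged, so the
-- restricted process has period two.

open import Defs
open import Algebra.Properties.CommutativeSemigroup using (interchange)
open import Data.Bool using (Bool; true; false; not; _∧_; _∨_; if_then_else_)
open import Data.Bool.Properties using (not-involutive; not-injective; not-¬; ⇔→≡; ∨-zeroʳ)
open import Data.Fin using (Fin; _≟_)
open import Data.List using ([]; _∷_; map; allFin)
open import Data.List.Properties using (map-cong)
open import Data.Nat using (ℕ; suc; _+_; _*_; _≤_; _≤ᵇ_)
open import Data.Nat.ListAction using (sum)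
open import Data.Nat.Properties
  using (+-commutativeSemigroup; *-cancelˡ-≤; +-cancelʳ-≤; +-mono-≤; ≤⇒≯; ≰⇒>; ≤ᵇ-reflects-≤;
         module ≤-Reasoning)
open import Data.Nat.Tactic.RingSolver using (solve)
open import Data.Product using (_×_; _,_)
open import Data.Sum using (_⊎_; inj₁; inj₂)
open import Function.Bundles using (mk⇔)
open import Relation.Nullary using (does; yes)
open import Relation.Nullary.Decidable using (dec-true)
open import Relation.Nullary.Reflects using (Reflects; ofʸ; ofⁿ; det)
open import Relation.Binary.PropositionalEquality

private
  variable
    n : ℕ
    G : Graph n
    P S : Fin n → Bool
    u v : Fin n

eqB-comm : ∀ x y → eqB x y ≡ eqB y x
eqB-comm true  true  = refl
eqB-comm true  false = refl
eqB-comm false true  = refl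
eqB-comm false false = refl

eqB-assoc : ∀ x y z → eqB (eqB x y) z ≡ eqB x (eqB y z)
eqB-assoc true  y     z = refl
eqB-assoc false true  z = refl
eqB-assoc false false z = sym (not-involutive z)

eqB-identityʳ : ∀ x → eqB x true ≡ x
eqB-identityʳ true  = refl
eqB-identityʳ false = refl

eqB-falseʳ : ∀ x → eqB x false ≡ not x
eqB-falseʳ true  = refl
eqB-falseʳ false = refl

eqB-self : ∀ x → eqB x x ≡ true
eqB-self true  = refl
eqB-self false = refl

eqB-not-self : ∀ x → eqB (not x) x ≡ false
eqB-not-self true  = refl
eqB-not-self false = refl

eqB-not-not : ∀ x y → eqB (not x) (not y) ≡ eqB x y
eqB-not-not true  true  = refl
eqB-not-not true  false = refl
eqB-not-not false true  = refl
eqB-not-not false false = refl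

eqB-notˡ : ∀ x y → eqB (not x) y ≡ eqB x (not y)
eqB-notˡ true  y = refl
eqB-notˡ false y = sym (not-involutive y)

eqB-≡-true : ∀ {x y} → eqB x y ≡ true → x ≡ y
eqB-≡-true {true}  {true}  _ = refl
eqB-≡-true {false} {false} _ = refl

eqB-cancelʳ : ∀ x y → eqB (eqB x y) y ≡ x
eqB-cancelʳ x y = begin
  eqB (eqB x y) y  ≡⟨ eqB-assoc x y y ⟩
  eqB x (eqB y y)  ≡⟨ cong (eqB x) (eqB-self y) ⟩
  eqB x true       ≡⟨ eqB-identityʳ x ⟩
  x                ∎
  where open ≡-Reasoning

eqB-shift : ∀ x y z → eqB x (eqB z y) ≡ eqB (eqB x y) z
eqB-shift x y z = begin
  eqB x (eqB z y)  ≡⟨ cong (eqB x) (eqB-comm z y) ⟩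
  eqB x (eqB y z)  ≡⟨ eqB-assoc x y z ⟨
  eqB (eqB x y) z  ∎
  where open ≡-Reasoning

eqB-interchange : ∀ w x y z → eqB (eqB w x) (eqB y z) ≡ eqB (eqB w y) (eqB x z)
eqB-interchange w x y z = begin
  eqB (eqB w x) (eqB y z)  ≡⟨ eqB-assoc w x (eqB y z) ⟩
  eqB w (eqB x (eqB y z))  ≡⟨ cong (eqB w) (eqB-assoc x y z) ⟨
  eqB w (eqB (eqB x y) z)  ≡⟨ cong (λ t → eqB w (eqB t z)) (eqB-comm x y) ⟩
  eqB w (eqB (eqB y x) z)  ≡⟨ cong (eqB w) (eqB-assoc y x z) ⟩
  eqB w (eqB y (eqB x z))  ≡⟨ eqB-assoc w y (eqB x z) ⟨
  eqB (eqB w y) (eqB x z)  ∎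
  where open ≡-Reasoning

∧-cong-guarded : ∀ {x y z} → (x ≡ true → y ≡ z) → x ∧ y ≡ x ∧ z
∧-cong-guarded {true}  y≡z = y≡z refl
∧-cong-guarded {false} _   = refl

∧-mono-true : ∀ {x x′ y y′} → (x ≡ true → x′ ≡ true) → (y ≡ true → y′ ≡ true) →
              x ∧ y ≡ true → x′ ∧ y′ ≡ true
∧-mono-true {true} {y = true} f g _ = cong₂ _∧_ (f refl) (g refl)

∧-true-left : ∀ {x y} → x ∧ y ≡ true → x ≡ true
∧-true-left {true} _ = refl

∧-true-right : ∀ {x y} → x ∧ y ≡ true → y ≡ true
∧-true-right {true} e = e

keeps : Rule → ℕ → ℕ → Bool
keeps MIN same other = same ≤ᵇ other
keeps MAJ same other = other ≤ᵇ same

if-≡-eqB : ∀ k y → (if k then y else not y) ≡ eqB k y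
if-≡-eqB true  y = refl
if-≡-eqB false y = refl

update-≡-eqB-keeps : ∀ M (adj : Graph n) c v →
  update M adj c v ≡ eqB (keeps M (nbCount adj c v (c v)) (nbCount adj c v (not (c v)))) (c v)
update-≡-eqB-keeps MIN adj c v = if-≡-eqB _ (c v)
update-≡-eqB-keeps MAJ adj c v = if-≡-eqB _ (c v)

update-≡-eqB-fixedB : ∀ M (adj : Graph n) c v → update M adj c v ≡ eqB (fixedB M adj c v) (c v)
update-≡-eqB-fixedB M adj c v = sym (eqB-cancelʳ (update M adj c v) (c v))

fixedB-≡-keeps : ∀ M (adj : Graph n) c v →
  fixedB M adj c v ≡ keeps M (nbCount adj c v (c v)) (nbCount adj c v (not (c v)))
fixedB-≡-keeps M adj c v =
  trans (cong (λ x → eqB x (c v)) (update-≡-eqB-keeps M adj c v)) (eqB-cancelʳ _ _)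

fixedB-update : ∀ M (adj : Graph n) c → (∀ u → update M adj (update M adj c) u ≡ c u) →
                ∀ v → fixedB M adj (update M adj c) v ≡ fixedB M adj c v
fixedB-update M adj c twoCycle v =
  trans (cong (λ x → eqB x (update M adj c v)) (twoCycle v)) (eqB-comm (c v) (update M adj c v))

+-cross-cancel : ∀ a b s o → a + s ≤ b + o → a + o ≤ b + s → a ≤ b
+-cross-cancel a b s o p q = *-cancelˡ-≤ 2 (+-cancelʳ-≤ (s + o) (2 * a) (2 * b) (begin
  2 * a + (s + o)    ≡⟨ solve (a ∷ s ∷ o ∷ []) ⟩
  (a + s) + (a + o)  ≤⟨ +-mono-≤ p q ⟩
  (b + o) + (b + s)  ≡⟨ solve (b ∷ s ∷ o ∷ []) ⟩
  2 * b + (s + o)    ∎))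
  where open ≤-Reasoning

≤ᵇ-cross-cancel : ∀ {k} a b s o → (a + s ≤ᵇ b + o) ≡ k → (a + o ≤ᵇ b + s) ≡ k → (a ≤ᵇ b) ≡ k
≤ᵇ-cross-cancel a b s o p q = det (≤ᵇ-reflects-≤ a b) (combine (reflects p) (reflects q))
  where
  reflects : ∀ {x y k} → (x ≤ᵇ y) ≡ k → Reflects (x ≤ y) k
  reflects {x} {y} eq = subst (Reflects (x ≤ y)) eq (≤ᵇ-reflects-≤ x y)
  combine : ∀ {k} → Reflects (a + s ≤ b + o) k → Reflects (a + o ≤ b + s) k → Reflects (a ≤ b) k
  combine (ofʸ p) (ofʸ q) = ofʸ (+-cross-cancel a b s o p q)
  combine (ofⁿ p) (ofⁿ q) = ofⁿ λ a≤b → ≤⇒≯ a≤b (+-cross-cancel (suc b) a o s (≰⇒> p) (≰⇒> q))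

keeps-cross-cancel : ∀ M {k} a b s o →
  keeps M (a + s) (b + o) ≡ k → keeps M (a + o) (b + s) ≡ k → keeps M a b ≡ k
keeps-cross-cancel MIN a b s o = ≤ᵇ-cross-cancel a b s o
keeps-cross-cancel MAJ a b s o = ≤ᵇ-cross-cancel b a o s

indicator : Bool → ℕ
indicator b = if b then 1 else 0

count : (Fin n → Bool) → ℕ
count {n} p = sum (map (λ u → indicator (p u)) (allFin n))

sum-map-+ : ∀ {A : Set} (f g : A → ℕ) xs →
            sum (map (λ x → f x + g x) xs) ≡ sum (map f xs) + sum (map g xs)
sum-map-+ f g []       = refl
sum-map-+ f g (x ∷ xs) = trans (cong (f x + g x +_) (sum-map-+ f g xs))
                               (interchange +-commutativeSemigroup (f x) (g x) _ _)

count-cong : ∀ {p q : Fin n → Bool} → (∀ u → p u ≡ q u) → count p ≡ count q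
count-cong {n} p≡q = cong sum (map-cong (λ u → cong indicator (p≡q u)) (allFin n))

count-cong-guarded : ∀ {p q r : Fin n → Bool} → (∀ u → p u ≡ true → q u ≡ r u) →
                     count (λ u → p u ∧ q u) ≡ count (λ u → p u ∧ r u)
count-cong-guarded q≡r = count-cong λ u → ∧-cong-guarded (q≡r u)

count-split : ∀ (p q r : Fin n → Bool) →
  count (λ u → p u ∧ r u)
    ≡ count (λ u → p u ∧ (q u ∧ r u)) + count (λ u → p u ∧ (not (q u) ∧ r u))
count-split {n} p q r =
  trans (cong sum (map-cong (λ u → indicator-split (p u) (q u) (r u)) (allFin n)))
        (sum-map-+ _ _ (allFin n))
  where
  indicator-split : ∀ x y z →
    indicator (x ∧ z) ≡ indicator (x ∧ (y ∧ z)) + indicator (x ∧ (not y ∧ z))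
  indicator-split false y     z     = refl
  indicator-split true  true  true  = refl
  indicator-split true  true  false = refl
  indicator-split true  false z     = refl

agree : Coloring n → Fin n → Fin n → Bool
agree c v u = eqB (c u) (c v)

agreeCount : Graph n → Coloring n → Fin n → (Fin n → Bool) → Bool → ℕ
agreeCount adj c v R b = count (λ u → adj v u ∧ (R u ∧ eqB (agree c v u) b))

nbCount-agree : ∀ (adj : Graph n) c v b →
  nbCount adj c v (eqB b (c v)) ≡ count (λ u → adj v u ∧ eqB (agree c v u) b)
nbCount-agree adj c v b = count-cong λ u → cong (adj v u ∧_) (eqB-shift (c u) (c v) b)

nbCount-split : ∀ (adj : Graph n) c v R b →
  nbCount adj c v (eqB b (c v)) ≡ agreeCount adj c v R b + agreeCount adj c v (λ u → not (R u)) b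
nbCount-split adj c v R b = trans (nbCount-agree adj c v b) (count-split (adj v) R _)

nbCount-induced : ∀ (adj : Graph n) S c v → S v ≡ true → ∀ b →
  nbCount (induced adj S) c v (eqB b (c v)) ≡ agreeCount adj c v S b
nbCount-induced adj S c v Sv b =
  trans (nbCount-agree (induced adj S) c v b)
        (count-cong λ u → reassoc {t = S u} {a = adj v u} Sv)
  where
  reassoc : ∀ {s t a x} → s ≡ true → (s ∧ t ∧ a) ∧ x ≡ a ∧ (t ∧ x)
  reassoc {t = true}  {a = true}  refl = refl
  reassoc {t = true}  {a = false} refl = refl
  reassoc {t = false} {a = true}  refl = refl
  reassoc {t = false} {a = false} refl = refl

agreeCount-cong : ∀ (adj : Graph n) d c v R {b b′} →
  (∀ u → adj v u ≡ true → R u ≡ true → eqB (agree d v u) b ≡ eqB (agree c v u) b′) →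
  agreeCount adj d v R b ≡ agreeCount adj c v R b′
agreeCount-cong adj d c v R same = count-cong-guarded λ u Gvu → ∧-cong-guarded (same u Gvu)

agree-update : ∀ M (adj : Graph n) c v u →
  agree (update M adj c) v u ≡ eqB (eqB (fixedB M adj c u) (fixedB M adj c v)) (agree c v u)
agree-update M adj c v u =
  trans (cong₂ eqB (update-≡-eqB-fixedB M adj c u) (update-≡-eqB-fixedB M adj c v))
        (eqB-interchange (fixedB M adj c u) (c u) (fixedB M adj c v) (c v))

fixedB-induced : ∀ M (G : Graph n) c S v → (∀ u → update M G (update M G c) u ≡ c u) →
  S v ≡ true → (∀ u → G v u ≡ true → eqB (fixedB M G c u) (fixedB M G c v) ≡ S u) →
  fixedB M (induced G S) c v ≡ fixedB M G c v
fixedB-induced M G c S v twoCycle Sv sameStatus = begin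
  fixedB M (induced G S) c v
    ≡⟨ fixedB-≡-keeps M (induced G S) c v ⟩
  keeps M (nbCount (induced G S) c v (c v)) (nbCount (induced G S) c v (not (c v)))
    ≡⟨ cong₂ (keeps M) (nbCount-induced G S c v Sv true) (nbCount-induced G S c v Sv false) ⟩
  keeps M (inside true) (inside false)
    ≡⟨ keeps-cross-cancel M _ _ _ _ statusBefore statusAfter ⟩
  fixedB M G c v
    ∎
  where
  open ≡-Reasoning
  c′ : Coloring _
  c′ = update M G c
  inside outside : Bool → ℕ
  inside  = agreeCount G c v S
  outside = agreeCount G c v (λ u → not (S u))

  statusBefore :
    keeps M (inside true + outside true) (inside false + outside false) ≡ fixedB M G c v
  statusBefore = sym (trans (fixedB-≡-keeps M G c v)
    (cong₂ (keeps M) (nbCount-split G c v S true) (nbCount-split G c v S false)))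

  agree-update-S : ∀ u → G v u ≡ true → agree c′ v u ≡ eqB (S u) (agree c v u)
  agree-update-S u Gvu =
    trans (agree-update M G c v u) (cong (λ x → eqB x (agree c v u)) (sameStatus u Gvu))

  nbCount-after : ∀ b → nbCount G c′ v (eqB b (c′ v)) ≡ inside b + outside (not b)
  nbCount-after b = trans (nbCount-split G c′ v S b)
    (cong₂ _+_ (agreeCount-cong G c′ c v S same)
               (agreeCount-cong G c′ c v (λ u → not (S u)) flipped))
    where
    same : ∀ u → G v u ≡ true → S u ≡ true → eqB (agree c′ v u) b ≡ eqB (agree c v u) b
    same u Gvu Su =
      cong (λ x → eqB x b) (trans (agree-update-S u Gvu) (cong (λ s → eqB s (agree c v u)) Su))
    flipped : ∀ u → G v u ≡ true → not (S u) ≡ true →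
              eqB (agree c′ v u) b ≡ eqB (agree c v u) (not b)
    flipped u Gvu ¬Su = begin
      eqB (agree c′ v u) b                     ≡⟨ cong (λ x → eqB x b) (agree-update-S u Gvu) ⟩
      eqB (eqB (S u) (agree c v u)) b          ≡⟨ cong (λ s → eqB (eqB s (agree c v u)) b)
                                                       (not-injective ¬Su) ⟩
      eqB (not (agree c v u)) b                ≡⟨ eqB-notˡ (agree c v u) b ⟩
      eqB (agree c v u) (not b)                ∎

  statusAfter : keeps M (inside true + outside false) (inside false + outside true) ≡ fixedB M G c v
  statusAfter = begin
    keeps M (inside true + outside false) (inside false + outside true)
      ≡⟨ cong₂ (keeps M) (nbCount-after true) (nbCount-after false) ⟨
    keeps M (nbCount G c′ v (c′ v)) (nbCount G c′ v (not (c′ v)))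
      ≡⟨ fixedB-≡-keeps M G c′ v ⟨
    fixedB M G c′ v
      ≡⟨ fixedB-update M G c twoCycle v ⟩
    fixedB M G c v
      ∎

insert : (Fin n → Bool) → Fin n → Fin n → Bool
insert S u w = S w ∨ does (w ≟ u)

⊆-insert : ∀ S (u : Fin n) → S ⊆ insert S u
⊆-insert S u w Sw rewrite Sw = refl

insert-here : ∀ S (u : Fin n) → insert S u u ≡ true
insert-here S u = trans (cong (S u ∨_) (dec-true (u ≟ u) refl)) (∨-zeroʳ (S u))

insert-elim : ∀ S (u w : Fin n) → insert S u w ≡ true → S w ≡ true ⊎ w ≡ u
insert-elim S u w e with S w | w ≟ u
... | true  | _        = inj₁ refl
... | false | yes w≡u  = inj₂ w≡u

walk-map : ∀ {adj adj′ : Graph n} → (∀ a b → adj a b ≡ true → adj′ a b ≡ true) →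
           ∀ {x y} → Walk adj x y → Walk adj′ x y
walk-map f here       = here
walk-map f (step e w) = step (f _ _ e) (walk-map f w)

walk-snoc : ∀ {adj : Graph n} {x y z} → Walk adj x y → adj y z ≡ true → Walk adj x z
walk-snoc here       e = step e here
walk-snoc (step e′ w) e = step e′ (walk-snoc w e)

induced-target : ∀ (adj : Graph n) S {v u} → induced adj S v u ≡ true → S u ≡ true
induced-target adj S {v} e = ∧-true-left (∧-true-right {S v} e)

induced-mono : ∀ {S S′} → S ⊆ S′ → ∀ a b → induced G S a b ≡ true → induced G S′ a b ≡ true
induced-mono S⊆S′ a b = ∧-mono-true (S⊆S′ a) (∧-mono-true (S⊆S′ b) (λ e → e))

connectedOn-insert : Symmetric G → ConnectedOn G S → S v ≡ true → G v u ≡ true →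
                     ConnectedOn G (insert S u)
connectedOn-insert {G = G} {S = S} {v = v} {u = u} symG conn Sv Gvu x y x∈ y∈ =
  walk (insert-elim S u x x∈) (insert-elim S u y y∈)
  where
  lift : ∀ {a b} → Walk (induced G S) a b → Walk (induced G (insert S u)) a b
  lift = walk-map (induced-mono {G = G} (⊆-insert S u))
  edge : ∀ a b → insert S u a ≡ true → insert S u b ≡ true → G a b ≡ true →
         induced G (insert S u) a b ≡ true
  edge a b ea eb eab = cong₂ _∧_ ea (cong₂ _∧_ eb eab)
  walk : ∀ {a b} → S a ≡ true ⊎ a ≡ u → S b ≡ true ⊎ b ≡ u → Walk (induced G (insert S u)) a b
  walk (inj₁ Sa)   (inj₁ Sb)   = lift (conn _ _ Sa Sb)
  walk (inj₁ Sa)   (inj₂ refl) =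
    walk-snoc (lift (conn _ v Sa Sv)) (edge v u (⊆-insert S u v Sv) (insert-here S u) Gvu)
  walk (inj₂ refl) (inj₁ Sb)   =
    step (edge u v (insert-here S u) (⊆-insert S u v Sv) (trans (symG u v) Gvu))
         (lift (conn v _ Sv Sb))
  walk (inj₂ refl) (inj₂ refl) = here

component-neighbour : Symmetric G → IsComponent G P S → S v ≡ true → G v u ≡ true → S u ≡ P u
component-neighbour {G = G} {P = P} {S = S} {u = u} symG (_ , S⊆P , conn , maximal) Sv Gvu =
  ⇔→≡ (mk⇔ (S⊆P u) λ Pu →
    maximal (insert S u) (⊆-insert S u) (insert⊆P Pu) (connectedOn-insert symG conn Sv Gvu)
            u (insert-here S u))
  where
  insert⊆P : P u ≡ true → insert S u ⊆ P
  insert⊆P Pu w e with insert-elim S u w e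
  ... | inj₁ Sw   = S⊆P w Sw
  ... | inj₂ refl = Pu

component-fixedB-induced : ∀ M (G : Graph n) c → Symmetric G →
  (∀ u → update M G (update M G c) u ≡ c u) →
  ∀ k P S → (∀ u → P u ≡ eqB (fixedB M G c u) k) → IsComponent G P S →
  ∀ v → S v ≡ true → fixedB M (induced G S) c v ≡ k
component-fixedB-induced M G c symG twoCycle k P S P≡ comp@(_ , S⊆P , _) v Sv =
  trans (fixedB-induced M G c S v twoCycle Sv sameStatus) fv≡k
  where
  open ≡-Reasoning
  fv≡k : fixedB M G c v ≡ k
  fv≡k = eqB-≡-true (trans (sym (P≡ v)) (S⊆P v Sv))
  sameStatus : ∀ u → G v u ≡ true → eqB (fixedB M G c u) (fixedB M G c v) ≡ S u
  sameStatus u Gvu = begin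
    eqB (fixedB M G c u) (fixedB M G c v)  ≡⟨ cong (eqB (fixedB M G c u)) fv≡k ⟩
    eqB (fixedB M G c u) k                 ≡⟨ P≡ u ⟨
    P u                                    ≡⟨ component-neighbour symG comp Sv Gvu ⟨
    S u                                    ∎

nbCount-flip : ∀ (adj : Graph n) d c v → (∀ u → adj v u ≡ true → d u ≡ not (c u)) →
  d v ≡ not (c v) → ∀ b → nbCount adj d v (eqB b (d v)) ≡ nbCount adj c v (eqB b (c v))
nbCount-flip adj d c v du dv b = begin
  nbCount adj d v (eqB b (d v))                ≡⟨ nbCount-agree adj d v b ⟩
  count (λ u → adj v u ∧ eqB (agree d v u) b)  ≡⟨ count-cong-guarded (λ u Gvu →
                                                    cong (λ x → eqB x b) (agree-flip u Gvu)) ⟩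
  count (λ u → adj v u ∧ eqB (agree c v u) b)  ≡⟨ nbCount-agree adj c v b ⟨
  nbCount adj c v (eqB b (c v))                ∎
  where
  open ≡-Reasoning
  agree-flip : ∀ u → adj v u ≡ true → agree d v u ≡ agree c v u
  agree-flip u Gvu = trans (cong₂ eqB (du u Gvu) dv) (eqB-not-not (c u) (c v))

update²-of-toggling : ∀ M (adj : Graph n) c v →
  (∀ u → adj v u ≡ true → update M adj c u ≡ not (c u)) → update M adj c v ≡ not (c v) →
  update M adj (update M adj c) v ≡ c v
update²-of-toggling M adj c v du dv = begin
  update M adj d v
    ≡⟨ update-≡-eqB-keeps M adj d v ⟩
  eqB (keeps M (nbCount adj d v (d v)) (nbCount adj d v (not (d v)))) (d v)
    ≡⟨ cong₂ (λ s o → eqB (keeps M s o) (d v))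
             (nbCount-flip adj d c v du dv true) (nbCount-flip adj d c v du dv false) ⟩
  eqB (keeps M (nbCount adj c v (c v)) (nbCount adj c v (not (c v)))) (d v)
    ≡⟨ cong₂ eqB (fixedB-≡-keeps M adj c v) (sym dv) ⟨
  eqB (fixedB M adj c v) (not (c v))
    ≡⟨ cong (λ x → eqB (eqB x (c v)) (not (c v))) dv ⟩
  eqB (eqB (not (c v)) (c v)) (not (c v))
    ≡⟨ cong (λ x → eqB x (not (c v))) (eqB-not-self (c v)) ⟩
  not (not (c v))
    ≡⟨ not-involutive (c v) ⟩
  c v
    ∎
  where
  open ≡-Reasoning
  d : Coloring _
  d = update M adj c

lemma21 : ∀ {n : ℕ} (T : Graph n) → IsTree T → (M : Rule) → (c : Coloring n) →
    InC2 M T c → (S : Fin n → Bool) →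
    (IsComponent T (fixedB M T c) S → FixedPointOn M T S c)
    × (IsComponent T (toggleB M T c) S → PureTwoCycleOn M T S c)
lemma21 T (symT , _) M c (_ , twoCycle) S = fixedPart , togglePart
  where
  statusOn : ∀ {P} k → (∀ u → P u ≡ eqB (fixedB M T c u) k) → IsComponent T P S →
             ∀ u → S u ≡ true → update M (induced T S) c u ≡ eqB k (c u)
  statusOn k P≡ comp u Su =
    trans (update-≡-eqB-fixedB M (induced T S) c u)
          (cong (λ x → eqB x (c u))
                (component-fixedB-induced M T c symT twoCycle k _ S P≡ comp u Su))

  fixedPart : IsComponent T (fixedB M T c) S → FixedPointOn M T S c
  fixedPart = statusOn true (λ u → sym (eqB-identityʳ _))

  togglePart : IsComponent T (toggleB M T c) S → PureTwoCycleOn M T S c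
  togglePart comp v Sv =
    update²-of-toggling M (induced T S) c v
      (λ u e → toggles u (induced-target T S e)) (toggles v Sv)
    , λ fixed → not-¬ refl (trans (sym fixed) (toggles v Sv))
    where
    toggles : ∀ u → S u ≡ true → update M (induced T S) c u ≡ not (c u)
    toggles = statusOn false (λ u → sym (eqB-falseʳ _)) comp
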